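{- Let $\preceq$ be an entrenchment relation satisfying Weak Left Disjunction. Then: (1) for all $\alpha,\beta\in\mathcal{L}$, $\alpha\mathrel{|\!\sim_\preceq}\beta$ implies $\alpha\mathrel{|\!\sim^w_\preceq}\beta$; (2) if $\preceq$ satisfies, in addition, Transitivity and Right Conjunction, then $\alpha\mathrel{|\!\sim^w_\preceq}\beta$ implies $\alpha\mathrel{|\!\sim_\preceq}\beta$.
   Context: $\mathcal{L}$ is the set of formulas of a propositional language closed under $\lor,\land,\neg,\to$. $\vdash\subseteq 2^{\mathcal{L}}\times\mathcal{L}$ is a fixed consequence relation including classical propositional logic, compact, satisfying the deduction theorem and disjunction in premises; $\alpha\vdash\beta$ means $\{\alpha\}\vdash\beta$; $\mathrm{Cn}(X)=\{\beta:X\vdash\beta\}$, $\mathrm{Cn}(X,\alpha)=\mathrm{Cn}(X\cup\{\alpha\})$. An entrenchment relation is a binary relation $\preceq$ on $\mathcal{L}$ such that for all $\alpha,\beta,\gamma$: $\alpha\preceq\alpha$; $\alpha\vdash\beta$ and $\beta\preceq\gamma$ imply $\alpha\preceq\gamma$; if $\alpha\vdash\beta$ and $\beta\vdash\alpha$ then $\gamma\preceq\alpha$ iff $\gamma\preceq\beta$. Properties (for all formulas): Weak Left Disjunction: $\alpha\lor\beta\preceq\alpha$ and $\alpha\lor\gamma\preceq\alpha$ imply $\alpha\lor\beta\lor\gamma\preceq\alpha$. Transitivity: $\alpha\preceq\beta$ and $\beta\preceq\gamma$ imply $\alpha\preceq\gamma$. Right Conjunction: $\gamma\preceq\alpha$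 and $\gamma\preceq\beta$ imply $\gamma\preceq\alpha\land\beta$. $\mathrm{Coh}(\alpha)=\{\beta:\beta\not\preceq\neg\alpha\}$. Maxiconsistent inference: $\mathcal{B}(\alpha)$ = deductively closed $U$ with $U\subseteq\mathrm{Coh}(\alpha)$; $\mathcal{B}_{\max}(\alpha)$ = those $U\in\mathcal{B}(\alpha)$ with no deductively closed $U'\supsetneq U$ in $\mathcal{B}(\alpha)$; $E(\alpha)=\bigcap\{\mathrm{Cn}(U,\alpha):U\in\mathcal{B}_{\max}(\alpha)\}$; $\alpha\mathrel{|\!\sim_\preceq}\beta$ iff $\beta\in E(\alpha)$. Weak maxiconsistent inference: $U^\alpha=\{\alpha\to\beta:\beta\in U\}$; $\mathcal{B}^w(\alpha)$ = deductively closed $U$ with $U^\alpha\subseteq\mathrm{Coh}(\alpha)$; $\mathcal{B}^w_{\max}(\alpha)$ = those $U\in\mathcal{B}^w(\alpha)$ such that no deductively closed $V\in\mathcal{B}^w(\alpha)$ has $U^\alpha\subsetneq V^\alpha$; $E^w(\alpha)=\bigcap\mathcal{B}^w_{\max}(\alpha)$; $\alpha\mathrel{|\!\sim^w_\preceq}\beta$ iff $\beta\in E^w(\alpha)$. Intersections of empty families are $\mathcal{L}$. -}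

module Defs where

open import Level using (0ℓ) renaming (suc to lsuc)
open import Data.Bool using (Bool; true; false; _∧_; _∨_; not)
open import Data.Product using (Σ; ∃; _×_; _,_)
open import Data.Sum using (_⊎_)
open import Data.List using (List)
open import Data.List.Relation.Unary.All using (All)
open import Data.List.Relation.Unary.Any using (Any)
open import Relation.Binary.PropositionalEquality using (_≡_)
open import Relation.Nullary using (¬_)
open import Relation.Unary using (Pred; _∈_; _⊆_; _⊂_; _∪_; ｛_｝)

data Form (At : Set) : Set where
  var  : At → Form At
  _∨̇_  : Form At → Form At → Form At
  _∧̇_  : Form At → Form At → Form At
  ¬̇_   : Form At → Form At
  _⇒_  : Form At → Form At → Form At

infixr 6 _∧̇_
infixr 5 _∨̇_
infixr 4 _⇒_
infix 7 ¬̇_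

FSet : Set → Set₁
FSet At = Pred (Form At) 0ℓ

-- Classical (two-valued) semantics, used to say that ⊢ includes
-- classical propositional logic.
eval : {At : Set} → (At → Bool) → Form At → Bool
eval v (var p)   = v p
eval v (a ∨̇ b)   = eval v a ∨ eval v b
eval v (a ∧̇ b)   = eval v a ∧ eval v b
eval v (¬̇ a)     = not (eval v a)
eval v (a ⇒ b)   = not (eval v a) ∨ eval v b

_⊨_ : {At : Set} → FSet At → Form At → Set
_⊨_ {At} X α = (v : At → Bool) → (∀ {φ} → φ ∈ X → eval v φ ≡ true) → eval v α ≡ true

listSet : {At : Set} → List (Form At) → FSet At
listSet xs φ = Any (φ ≡_) xs

record ConsequenceRelation (At : Set) : Set₁ where
  field
    _⊢_ : FSet At → Form At → Set
    reflexivity  : ∀ {X α} → α ∈ X → X ⊢ α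
    monotonicity : ∀ {X Y α} → X ⊆ Y → X ⊢ α → Y ⊢ α
    cut          : ∀ {X Y α} → (∀ {β} → β ∈ Y → X ⊢ β) → Y ⊢ α → X ⊢ α
    supraclassical : ∀ {X α} → X ⊨ α → X ⊢ α
    compact : ∀ {X α} → X ⊢ α →
              Σ (List (Form At)) λ xs → All (_∈ X) xs × listSet xs ⊢ α
    deduction  : ∀ {X α β} → (X ∪ ｛ α ｝) ⊢ β → X ⊢ (α ⇒ β)
    deduction⁻ : ∀ {X α β} → X ⊢ (α ⇒ β) → (X ∪ ｛ α ｝) ⊢ β
    disjPremises : ∀ {X α β γ} → (X ∪ ｛ α ｝) ⊢ γ → (X ∪ ｛ β ｝) ⊢ γ →
                   (X ∪ ｛ α ∨̇ β ｝) ⊢ γ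

module Inference {At : Set} (CR : ConsequenceRelation At) where
  open ConsequenceRelation CR

  _⊢₁_ : Form At → Form At → Set
  α ⊢₁ β = ｛ α ｝ ⊢ β

  Cn : FSet At → FSet At
  Cn X β = X ⊢ β

  DedClosed : FSet At → Set
  DedClosed U = Cn U ⊆ U

  record IsEntrenchment (_≼_ : Form At → Form At → Set) : Set where
    field
      refl≼   : ∀ {α} → α ≼ α
      left≼   : ∀ {α β γ} → α ⊢₁ β → β ≼ γ → α ≼ γ
      equiv≼  : ∀ {α β γ} → α ⊢₁ β → β ⊢₁ α → (γ ≼ α → γ ≼ β) × (γ ≼ β → γ ≼ α)

  module _ (_≼_ : Form At → Form At → Set) where

    WeakLeftDisjunction : Set
    WeakLeftDisjunction = ∀ α β γ →
      ((α ∨̇ β) ≼ α) → ((α ∨̇ γ) ≼ α) → ((α ∨̇ β ∨̇ γ) ≼ α)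

    Transitivity : Set
    Transitivity = ∀ α β γ → α ≼ β → β ≼ γ → α ≼ γ

    RightConjunction : Set
    RightConjunction = ∀ α β γ → γ ≼ α → γ ≼ β → γ ≼ (α ∧̇ β)

    Coh : Form At → FSet At
    Coh α β = ¬ (β ≼ (¬̇ α))

    𝓑 : Form At → FSet At → Set
    𝓑 α U = DedClosed U × U ⊆ Coh α

    𝓑max : Form At → FSet At → Set₁
    𝓑max α U = 𝓑 α U × (∀ (U' : FSet At) → 𝓑 α U' → ¬ (U ⊂ U'))

    E : Form At → Pred (Form At) (lsuc 0ℓ)
    E α β = ∀ (U : FSet At) → 𝓑max α U → (U ∪ ｛ α ｝) ⊢ β

    _|~_ : Form At → Form At → Set₁
    α |~ β = β ∈ E α

    _^_ : FSet At → Form At → FSet At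
    (U ^ α) φ = Σ (Form At) λ β → β ∈ U × φ ≡ (α ⇒ β)

    𝓑ʷ : Form At → FSet At → Set
    𝓑ʷ α U = DedClosed U × (U ^ α) ⊆ Coh α

    𝓑ʷmax : Form At → FSet At → Set₁
    𝓑ʷmax α U = 𝓑ʷ α U × (∀ (V : FSet At) → 𝓑ʷ α V → ¬ ((U ^ α) ⊂ (V ^ α)))

    Eʷ : Form At → Pred (Form At) (lsuc 0ℓ)
    Eʷ α β = ∀ (U : FSet At) → 𝓑ʷmax α U → β ∈ U

    _|~ʷ_ : Form At → Form At → Set₁
    α |~ʷ β = β ∈ Eʷ α

-- Classical metatheory (the paper works in ZFC): Zorn's lemma for
-- families of sets of formulas ordered by inclusion, with chains given
-- as indexed families (so that their unions stay in Set).

Zorn : Set → Set₁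
Zorn A = (P : Pred (Pred A 0ℓ) 0ℓ) →
  (∀ (I : Set) (F : I → Pred A 0ℓ) → (∀ i → P (F i)) →
     (∀ i j → F i ⊆ F j ⊎ F j ⊆ F i) →
     Σ (Pred A 0ℓ) λ W → P W × (∀ i → F i ⊆ W)) →
  ∀ X → P X → Σ (Pred A 0ℓ) λ M → P M × X ⊆ M ×
     (∀ M' → P M' → M ⊆ M' → M' ⊆ M)

{-# OPTIONS --safe #-}
module Submission where

open import Defs
open import Level using (0ℓ)
open import Axiom.ExcludedMiddle using (ExcludedMiddle)
open import Data.Bool using (Bool; true; false; T; not; _∧_; _∨_)
open import Data.Bool.Properties using (T-∧; T-≡)
open import Data.Empty using (⊥-elim)
open import Data.Fin as Fin using (Fin)
open import Data.Nat using (zero; suc)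
open import Data.List.Relation.Unary.All as All using (All; []; _∷_)
open import Data.Product using (Σ; _×_; _,_; proj₁; proj₂)
open import Data.Sum using (_⊎_; inj₁; inj₂)
open import Data.Vec using (Vec; []; _∷_; lookup; tabulate)
open import Data.Vec.Properties using (lookup∘tabulate)
open import Function using (_∘_; id)
open import Function.Bundles using (Equivalence)
open import Relation.Binary.PropositionalEquality using (_≡_; refl; sym; trans; cong; cong₂)
open import Relation.Nullary using (¬_; yes; no)
open import Relation.Unary using (Pred; _∈_; _∉_; _⊆_; _⊂_; _∪_; _∩_; ⋃; ｛_｝)

-- (1) Let U be weakly maximal for α with β ∉ U. The members of U implied by ¬α
-- form a coherent theory; extend it by Zorn's lemma to a maximal coherent W.
-- Then Cn(W, α) is weakly coherent and contains U, so weak maximality of U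
-- makes it equal to U; but α |~ β puts β into Cn(W, α).
--
-- (2) Let U be maximal coherent for α with α → β ∉ U, so that U + (α → β) is
-- incoherent: it contains some δ ≼ ¬α. Then U + (α ∧ ¬β) is weakly coherent,
-- for otherwise some w ∈ U has w ∧ (α → β) ≼ ¬α and ¬α ∨ (w ∧ ¬β) ≼ ¬α, and
-- Weak Left Disjunction, Transitivity and Right Conjunction give w ≼ ¬α.
-- A weakly maximal extension of U + (α ∧ ¬β) contains β (as α |~ʷ β) and ¬β,
-- hence ¬α, which no weakly coherent theory contains.

infix 30 _[_]

_[_] : {A B : Set} → Form A → (A → Form B) → Form B
var p   [ σ ] = σ p
(φ ∨̇ ψ) [ σ ] = φ [ σ ] ∨̇ ψ [ σ ]
(φ ∧̇ ψ) [ σ ] = φ [ σ ] ∧̇ ψ [ σ ]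
(¬̇ φ)   [ σ ] = ¬̇ φ [ σ ]
(φ ⇒ ψ) [ σ ] = φ [ σ ] ⇒ ψ [ σ ]

eval-[] : {A B : Set} (v : B → Bool) (σ : A → Form B) (φ : Form A) →
          eval v (φ [ σ ]) ≡ eval (eval v ∘ σ) φ
eval-[] v σ (var p)   = refl
eval-[] v σ (φ ∨̇ ψ)   = cong₂ _∨_ (eval-[] v σ φ) (eval-[] v σ ψ)
eval-[] v σ (φ ∧̇ ψ)   = cong₂ _∧_ (eval-[] v σ φ) (eval-[] v σ ψ)
eval-[] v σ (¬̇ φ)     = cong not (eval-[] v σ φ)
eval-[] v σ (φ ⇒ ψ)   = cong₂ (λ a b → not a ∨ b) (eval-[] v σ φ) (eval-[] v σ ψ)

eval-cong : {A : Set} {v w : A → Bool} → (∀ p → v p ≡ w p) → (φ : Form A) →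
            eval v φ ≡ eval w φ
eval-cong v≗w (var p)   = v≗w p
eval-cong v≗w (φ ∨̇ ψ)   = cong₂ _∨_ (eval-cong v≗w φ) (eval-cong v≗w ψ)
eval-cong v≗w (φ ∧̇ ψ)   = cong₂ _∧_ (eval-cong v≗w φ) (eval-cong v≗w ψ)
eval-cong v≗w (¬̇ φ)     = cong not (eval-cong v≗w φ)
eval-cong v≗w (φ ⇒ ψ)   = cong₂ (λ a b → not a ∨ b) (eval-cong v≗w φ) (eval-cong v≗w ψ)

allValuations : ∀ n → (Vec Bool n → Bool) → Bool
allValuations zero    f = f []
allValuations (suc n) f = allValuations n (f ∘ (true ∷_)) ∧ allValuations n (f ∘ (false ∷_))

allValuations-sound : ∀ {n} (f : Vec Bool n → Bool) → T (allValuations n f) → ∀ bs → T (f bs)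
allValuations-sound f valid [] = valid
allValuations-sound f valid (true ∷ bs) =
  allValuations-sound (f ∘ (true ∷_)) (proj₁ (Equivalence.to T-∧ valid)) bs
allValuations-sound f valid (false ∷ bs) =
  allValuations-sound (f ∘ (false ∷_)) (proj₂ (Equivalence.to T-∧ valid)) bs

Tautology : ∀ {n} → Form (Fin n) → Set
Tautology {n} φ = T (allValuations n (λ bs → eval (lookup bs) φ))

tautology-true : ∀ {n} {φ : Form (Fin n)} → Tautology φ → ∀ v → eval v φ ≡ true
tautology-true {φ = φ} taut v =
  trans (sym (eval-cong (lookup∘tabulate v) φ))
        (Equivalence.to T-≡ (allValuations-sound _ taut (tabulate v)))

pattern p₀ = var Fin.zero
pattern p₁ = var (Fin.suc Fin.zero)
pattern p₂ = var (Fin.suc (Fin.suc Fin.zero))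
pattern p₃ = var (Fin.suc (Fin.suc (Fin.suc Fin.zero)))

module Consequence {At : Set} (CR : ConsequenceRelation At) where
  open ConsequenceRelation CR
  open Inference CR

  ⊢-cut₁ : ∀ {X α β} → X ⊢ α → α ⊢₁ β → X ⊢ β
  ⊢-cut₁ X⊢α α⊢β = cut (λ { refl → X⊢α }) α⊢β

  ⊢-∧-intro : ∀ {X α β} → X ⊢ α → X ⊢ β → X ⊢ (α ∧̇ β)
  ⊢-∧-intro {α = α} {β} X⊢α X⊢β =
    cut {Y = ｛ α ｝ ∪ ｛ β ｝} (λ { (inj₁ refl) → X⊢α ; (inj₂ refl) → X⊢β })
        (supraclassical (λ v v⊨Y → cong₂ _∧_ (v⊨Y (inj₁ refl)) (v⊨Y (inj₂ refl))))

  -- For a valid schema, Tautology (φ ⇒ ψ) computes to ⊤, so the implicit proof is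
  -- found by evaluation and call sites only name the schema and its instance σ.
  ⊢₁-tautology : ∀ {n} (φ ψ : Form (Fin n)) (σ : Vec (Form At) n) →
                 {Tautology (φ ⇒ ψ)} → φ [ lookup σ ] ⊢₁ ψ [ lookup σ ]
  ⊢₁-tautology φ ψ σ {taut} = supraclassical λ v v⊨φσ →
    trans (eval-[] v (lookup σ) ψ)
          (modusPonens (tautology-true {φ = φ ⇒ ψ} taut (eval v ∘ lookup σ))
                       (trans (sym (eval-[] v (lookup σ) φ)) (v⊨φσ refl)))
    where
    modusPonens : ∀ {a b} → (not a ∨ b) ≡ true → a ≡ true → b ≡ true
    modusPonens a⇒b refl = a⇒b

  Cn-closed : ∀ X → DedClosed (Cn X)
  Cn-closed X = cut id

  closed-⊢₁ : ∀ {U α β} → DedClosed U → α ∈ U → α ⊢₁ β → β ∈ U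
  closed-⊢₁ U-closed α∈U α⊢β = U-closed (⊢-cut₁ (reflexivity α∈U) α⊢β)

  ⇒⊢₁-of-¬⊢₁ : ∀ {α γ} → (¬̇ α) ⊢₁ γ → (α ⇒ γ) ⊢₁ γ
  ⇒⊢₁-of-¬⊢₁ {α} {γ} ¬α⊢γ =
    ⊢-cut₁ (⊢-∧-intro (reflexivity refl) (deduction (monotonicity inj₂ ¬α⊢γ)))
           (⊢₁-tautology ((p₀ ⇒ p₁) ∧̇ (¬̇ p₀ ⇒ p₁)) p₁ (α ∷ γ ∷ []))

  Chain : {I : Set} → (I → FSet At) → Set
  Chain {I} F = ∀ i j → F i ⊆ F j ⊎ F j ⊆ F i

  All-∈-chain : ∀ {X : FSet At} {I} {F : I → FSet At} → (∀ i → X ⊆ F i) → Chain F →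
                ∀ {xs} → All (_∈ X ∪ ⋃ I F) xs → All (_∈ X) xs ⊎ Σ I (λ i → All (_∈ F i) xs)
  All-∈-chain X⊆F chain [] = inj₁ []
  All-∈-chain X⊆F chain (x∈ ∷ xs∈) with x∈ | All-∈-chain X⊆F chain xs∈
  ... | inj₁ x∈X       | inj₁ xs∈X       = inj₁ (x∈X ∷ xs∈X)
  ... | inj₁ x∈X       | inj₂ (i , xs∈F) = inj₂ (i , X⊆F i x∈X ∷ xs∈F)
  ... | inj₂ (j , x∈F) | inj₁ xs∈X       = inj₂ (j , x∈F ∷ All.map (X⊆F j) xs∈X)
  ... | inj₂ (j , x∈F) | inj₂ (i , xs∈F) with chain i j
  ...   | inj₁ Fi⊆Fj = inj₂ (j , x∈F ∷ All.map Fi⊆Fj xs∈F)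
  ...   | inj₂ Fj⊆Fi = inj₂ (i , Fj⊆Fi x∈F ∷ xs∈F)

  chain-union-closed : ∀ {X : FSet At} {I} {F : I → FSet At} → DedClosed X →
                       (∀ i → DedClosed (F i)) → (∀ i → X ⊆ F i) → Chain F →
                       DedClosed (X ∪ ⋃ I F)
  chain-union-closed X-closed F-closed X⊆F chain ⊢φ with compact ⊢φ
  ... | xs , xs∈ , xs⊢φ with All-∈-chain X⊆F chain xs∈
  ...   | inj₁ xs∈X       = inj₁ (X-closed (monotonicity (All.lookup xs∈X) xs⊢φ))
  ...   | inj₂ (i , xs∈F) = inj₂ (i , F-closed i (monotonicity (All.lookup xs∈F) xs⊢φ))

  ClosedIn : FSet At → FSet At → Set
  ClosedIn C Y = DedClosed Y × Y ⊆ C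

  Maximal : (FSet At → Set) → FSet At → Set₁
  Maximal P M = ∀ N → P N → M ⊆ N → N ⊆ M

  closed-maximal-extension : Zorn (Form At) → ∀ C X → ClosedIn C X →
    Σ (FSet At) λ M → ClosedIn C M × X ⊆ M × Maximal (ClosedIn C) M
  closed-maximal-extension zorn C X X-closedIn@(X-closed , X⊆C)
    with zorn Above upperBound X (X-closedIn , id)
    where
    Above : Pred (FSet At) 0ℓ
    Above Y = ClosedIn C Y × X ⊆ Y
    upperBound : ∀ I (F : I → FSet At) → (∀ i → Above (F i)) → Chain F →
                 Σ (FSet At) λ W → Above W × (∀ i → F i ⊆ W)
    -- X is included so that the empty chain also has an upper bound above X.
    upperBound I F F-above chain =
      X ∪ ⋃ I F ,
      ( ( chain-union-closed X-closed (proj₁ ∘ proj₁ ∘ F-above) (proj₂ ∘ F-above) chain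
        , λ { (inj₁ x∈X) → X⊆C x∈X ; (inj₂ (i , x∈F)) → proj₂ (proj₁ (F-above i)) x∈F } )
      , inj₁ )
      , λ i x∈F → inj₂ (i , x∈F)
  ... | M , (M-closedIn , X⊆M) , _ , M-maximal =
    M , M-closedIn , X⊆M , λ N N-closedIn M⊆N → M-maximal N (N-closedIn , M⊆N ∘ X⊆M) M⊆N

  ⊆-Cn-∪ : ∀ {U W α} → DedClosed U → U ∩ Cn ｛ ¬̇ α ｝ ⊆ W → U ⊆ Cn (W ∪ ｛ α ｝)
  ⊆-Cn-∪ {α = α} U-closed U∩⊆W {u} u∈U =
    deduction⁻ (reflexivity (U∩⊆W
      ( closed-⊢₁ U-closed u∈U (⊢₁-tautology p₁ (p₀ ⇒ p₁) (α ∷ u ∷ []))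
      , ⊢₁-tautology (¬̇ p₀) (p₀ ⇒ p₁) (α ∷ u ∷ []) )))

  module Entrenchment (_≼_ : Form At → Form At → Set) (entrenchment : IsEntrenchment _≼_) where
    open IsEntrenchment entrenchment

    ^-mono : ∀ {U V α} → U ⊆ V → _^_ _≼_ U α ⊆ _^_ _≼_ V α
    ^-mono U⊆V (β , β∈U , refl) = β , U⊆V β∈U , refl

    ^-injective : ∀ {U V α} → _^_ _≼_ U α ⊆ _^_ _≼_ V α → U ⊆ V
    ^-injective U^⊆V^ {β} β∈U with U^⊆V^ (β , β∈U , refl)
    ... | .β , β∈V , refl = β∈V

    ≼-resp-⊣⊢ : ∀ {α β γ} → α ⊢₁ β → β ⊢₁ α → γ ≼ α → γ ≼ β
    ≼-resp-⊣⊢ α⊢β β⊢α = proj₁ (equiv≼ α⊢β β⊢α)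

    𝓑max-extension : Zorn (Form At) → ∀ {α X} → 𝓑 _≼_ α X →
                     Σ (FSet At) λ M → 𝓑max _≼_ α M × X ⊆ M
    𝓑max-extension zorn {α} {X} X∈𝓑
      with closed-maximal-extension zorn (Coh _≼_ α) X X∈𝓑
    ... | M , M∈𝓑 , X⊆M , M-maximal =
      M , (M∈𝓑 , λ N N∈𝓑 (M⊆N , N⊈M) → N⊈M (M-maximal N N∈𝓑 M⊆N)) , X⊆M

    𝓑ʷmax-extension : Zorn (Form At) → ∀ {α X} → 𝓑ʷ _≼_ α X →
                      Σ (FSet At) λ M → 𝓑ʷmax _≼_ α M × X ⊆ M
    𝓑ʷmax-extension zorn {α} {X} (X-closed , X^⊆Coh)
      with closed-maximal-extension zorn (Coh _≼_ α ∘ (α ⇒_)) X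
             (X-closed , λ β∈X → X^⊆Coh (_ , β∈X , refl))
    ... | M , (M-closed , M⊆C) , X⊆M , M-maximal =
      M , ((M-closed , λ { (_ , β∈M , refl) → M⊆C β∈M }) , M-max) , X⊆M
      where
      M-max : ∀ N → 𝓑ʷ _≼_ α N → ¬ (_^_ _≼_ M α ⊂ _^_ _≼_ N α)
      M-max N (N-closed , N^⊆Coh) (M^⊆N^ , N^⊈M^) =
        N^⊈M^ (^-mono (M-maximal N (N-closed , λ β∈N → N^⊆Coh (_ , β∈N , refl))
                                 (^-injective M^⊆N^)))

    𝓑ʷ⇒𝓑-∩-Cn¬ : ∀ {α U} → 𝓑ʷ _≼_ α U → 𝓑 _≼_ α (U ∩ Cn ｛ ¬̇ α ｝)
    𝓑ʷ⇒𝓑-∩-Cn¬ (U-closed , U^⊆Coh) =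
      (λ ⊢φ → U-closed (monotonicity proj₁ ⊢φ) , cut proj₂ ⊢φ) ,
      λ { (γ∈U , ¬α⊢γ) γ≼¬α → U^⊆Coh (_ , γ∈U , refl) (left≼ (⇒⊢₁-of-¬⊢₁ ¬α⊢γ) γ≼¬α) }

    𝓑⇒𝓑ʷ-Cn-∪ : ∀ {α W} → 𝓑 _≼_ α W → 𝓑ʷ _≼_ α (Cn (W ∪ ｛ α ｝))
    𝓑⇒𝓑ʷ-Cn-∪ (W-closed , W⊆Coh) =
      Cn-closed _ , λ { (_ , W,α⊢δ , refl) → W⊆Coh (W-closed (deduction W,α⊢δ)) }

    |~⇒|~ʷ : ExcludedMiddle 0ℓ → Zorn (Form At) →
             ∀ α β → _|~_ _≼_ α β → _|~ʷ_ _≼_ α β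
    |~⇒|~ʷ em zorn α β α|~β U (U∈𝓑ʷ , U-max) with em {β ∈ U}
    ... | yes β∈U = β∈U
    ... | no β∉U with 𝓑max-extension zorn (𝓑ʷ⇒𝓑-∩-Cn¬ U∈𝓑ʷ)
    ...   | W , W∈𝓑max , U∩⊆W = ⊥-elim (U-max V V∈𝓑ʷ (^-mono U⊆V , V^⊈U^))
      where
      V = Cn (W ∪ ｛ α ｝)
      V∈𝓑ʷ : 𝓑ʷ _≼_ α V
      V∈𝓑ʷ = 𝓑⇒𝓑ʷ-Cn-∪ (proj₁ W∈𝓑max)
      U⊆V : U ⊆ V
      U⊆V = ⊆-Cn-∪ (proj₁ U∈𝓑ʷ) U∩⊆W
      V^⊈U^ : ¬ (_^_ _≼_ V α ⊆ _^_ _≼_ U α)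
      V^⊈U^ V^⊆U^ = β∉U (^-injective V^⊆U^ (α|~β W W∈𝓑max))

    𝓑ʷ-∌¬ : ∀ {α V} → 𝓑ʷ _≼_ α V → ¬̇ α ∉ V
    𝓑ʷ-∌¬ {α} (V-closed , V^⊆Coh) ¬α∈V =
      V^⊆Coh (_ , ¬α∈V , refl) (left≼ (⊢₁-tautology (p₀ ⇒ ¬̇ p₀) (¬̇ p₀) (α ∷ [])) refl≼)

    |~ʷ-𝓑ʷ-∌¬ : Zorn (Form At) → ∀ {α β V} → _|~ʷ_ _≼_ α β → 𝓑ʷ _≼_ α V → ¬̇ β ∉ V
    |~ʷ-𝓑ʷ-∌¬ zorn {α} {β} α|~ʷβ V∈𝓑ʷ ¬β∈V with 𝓑ʷmax-extension zorn V∈𝓑ʷ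
    ... | M , M∈𝓑ʷmax@(M∈𝓑ʷ@(M-closed , _) , _) , V⊆M =
      𝓑ʷ-∌¬ M∈𝓑ʷ (closed-⊢₁ M-closed (M-closed (⊢-∧-intro (reflexivity (α|~ʷβ M M∈𝓑ʷmax))
                                                            (reflexivity (V⊆M ¬β∈V))))
                                    (⊢₁-tautology (p₁ ∧̇ ¬̇ p₁) (¬̇ p₀) (α ∷ β ∷ [])))

    ≼-absorb : RightConjunction _≼_ → ∀ {α γ δ} → γ ≼ α →
               (γ ∧̇ α) ⊢₁ δ → δ ⊢₁ (γ ∧̇ α) → γ ≼ δ
    ≼-absorb rc γ≼α γ∧α⊢δ δ⊢γ∧α = ≼-resp-⊣⊢ γ∧α⊢δ δ⊢γ∧α (rc _ _ _ refl≼ γ≼α)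

    ≼¬-split : WeakLeftDisjunction _≼_ → Transitivity _≼_ → RightConjunction _≼_ →
               ∀ α β w → (w ∧̇ (α ⇒ β)) ≼ (¬̇ α) → (¬̇ α ∨̇ (w ∧̇ ¬̇ β)) ≼ (¬̇ α) → w ≼ (¬̇ α)
    -- Right Conjunction pushes both hypotheses below m = w ∧ ¬α; Weak Left
    -- Disjunction then joins the cases β and ¬β into w ≼ m.
    ≼¬-split wld tr rc α β w w∧[α⇒β]≼¬α ¬α∨[w∧¬β]≼¬α = tr _ _ _ w≼m m≼¬α
      where
      σ = α ∷ β ∷ w ∷ []
      m = w ∧̇ ¬̇ α
      m≼¬α : m ≼ (¬̇ α)
      m≼¬α = left≼ (⊢₁-tautology (p₂ ∧̇ ¬̇ p₀) (p₂ ∧̇ (p₀ ⇒ p₁)) σ) w∧[α⇒β]≼¬α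
      w∧[α⇒β]≼m : (w ∧̇ (α ⇒ β)) ≼ m
      w∧[α⇒β]≼m = ≼-absorb rc w∧[α⇒β]≼¬α
        (⊢₁-tautology ((p₂ ∧̇ (p₀ ⇒ p₁)) ∧̇ ¬̇ p₀) (p₂ ∧̇ ¬̇ p₀) σ)
        (⊢₁-tautology (p₂ ∧̇ ¬̇ p₀) ((p₂ ∧̇ (p₀ ⇒ p₁)) ∧̇ ¬̇ p₀) σ)
      m∨[w∧β]≼m : (m ∨̇ (w ∧̇ β)) ≼ m
      m∨[w∧β]≼m = left≼ (⊢₁-tautology ((p₂ ∧̇ ¬̇ p₀) ∨̇ (p₂ ∧̇ p₁)) (p₂ ∧̇ (p₀ ⇒ p₁)) σ) w∧[α⇒β]≼m
      m∨[w∧¬β]≼m : (m ∨̇ (w ∧̇ ¬̇ β)) ≼ m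
      m∨[w∧¬β]≼m = ≼-absorb rc
        (left≼ (⊢₁-tautology ((p₂ ∧̇ ¬̇ p₀) ∨̇ (p₂ ∧̇ ¬̇ p₁)) (¬̇ p₀ ∨̇ (p₂ ∧̇ ¬̇ p₁)) σ)
               ¬α∨[w∧¬β]≼¬α)
        (⊢₁-tautology (((p₂ ∧̇ ¬̇ p₀) ∨̇ (p₂ ∧̇ ¬̇ p₁)) ∧̇ ¬̇ p₀) (p₂ ∧̇ ¬̇ p₀) σ)
        (⊢₁-tautology (p₂ ∧̇ ¬̇ p₀) (((p₂ ∧̇ ¬̇ p₀) ∨̇ (p₂ ∧̇ ¬̇ p₁)) ∧̇ ¬̇ p₀) σ)
      w≼m : w ≼ m
      w≼m = left≼ (⊢₁-tautology p₂ ((p₂ ∧̇ ¬̇ p₀) ∨̇ (p₂ ∧̇ p₁) ∨̇ (p₂ ∧̇ ¬̇ p₁)) σ)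
                  (wld m (w ∧̇ β) (w ∧̇ ¬̇ β) m∨[w∧β]≼m m∨[w∧¬β]≼m)

    𝓑ʷ-Cn-∪-∧¬ : WeakLeftDisjunction _≼_ → Transitivity _≼_ → RightConjunction _≼_ →
                 ∀ {α β δ U} → 𝓑 _≼_ α U → δ ∈ Cn (U ∪ ｛ α ⇒ β ｝) → δ ≼ (¬̇ α) →
                 𝓑ʷ _≼_ α (Cn (U ∪ ｛ α ∧̇ ¬̇ β ｝))
    𝓑ʷ-Cn-∪-∧¬ wld tr rc {α} {β} {δ} {U} (U-closed , U⊆Coh) U,α⇒β⊢δ δ≼¬α =
      Cn-closed _ , coherent
      where
      coherent : _^_ _≼_ (Cn (U ∪ ｛ α ∧̇ ¬̇ β ｝)) α ⊆ Coh _≼_ α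
      coherent (γ , U,α∧¬β⊢γ , refl) α⇒γ≼¬α =
        U⊆Coh w∈U (≼¬-split wld tr rc α β w w∧[α⇒β]≼¬α ¬α∨[w∧¬β]≼¬α)
        where
        u = (α ∧̇ ¬̇ β) ⇒ γ
        v = (α ⇒ β) ⇒ δ
        w = u ∧̇ v
        w∈U : w ∈ U
        w∈U = U-closed (⊢-∧-intro (reflexivity (U-closed (deduction U,α∧¬β⊢γ)))
                                  (reflexivity (U-closed (deduction U,α⇒β⊢δ))))
        w∧[α⇒β]≼¬α : (w ∧̇ (α ⇒ β)) ≼ (¬̇ α)
        w∧[α⇒β]≼¬α = left≼ (⊢₁-tautology ((p₀ ∧̇ (p₁ ⇒ p₂)) ∧̇ p₁) p₂ (u ∷ (α ⇒ β) ∷ δ ∷ [])) δ≼¬α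
        ¬α∨[w∧¬β]≼¬α : (¬̇ α ∨̇ (w ∧̇ ¬̇ β)) ≼ (¬̇ α)
        ¬α∨[w∧¬β]≼¬α =
          left≼ (⊢₁-tautology (¬̇ p₀ ∨̇ ((((p₀ ∧̇ ¬̇ p₁) ⇒ p₂) ∧̇ p₃) ∧̇ ¬̇ p₁)) (p₀ ⇒ p₂)
                              (α ∷ β ∷ γ ∷ v ∷ []))
                α⇒γ≼¬α

    |~ʷ⇒|~ : ExcludedMiddle 0ℓ → Zorn (Form At) →
             WeakLeftDisjunction _≼_ → Transitivity _≼_ → RightConjunction _≼_ →
             ∀ α β → _|~ʷ_ _≼_ α β → _|~_ _≼_ α β
    |~ʷ⇒|~ em zorn wld tr rc α β α|~ʷβ U (U∈𝓑 , U-max) with em {(α ⇒ β) ∈ U}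
    ... | yes α⇒β∈U = deduction⁻ (reflexivity α⇒β∈U)
    ... | no α⇒β∉U = ⊥-elim (U-max U⁺ (Cn-closed _ , U⁺⊆Coh) (U⊆U⁺ , U⁺⊈U))
      where
      U⁺ = Cn (U ∪ ｛ α ⇒ β ｝)
      U⊆U⁺ : U ⊆ U⁺
      U⊆U⁺ = reflexivity ∘ inj₁
      U⁺⊈U : ¬ (U⁺ ⊆ U)
      U⁺⊈U U⁺⊆U = α⇒β∉U (U⁺⊆U (reflexivity (inj₂ refl)))
      U⁺⊆Coh : U⁺ ⊆ Coh _≼_ α
      U⁺⊆Coh U⁺⊢δ δ≼¬α =
        |~ʷ-𝓑ʷ-∌¬ zorn α|~ʷβ (𝓑ʷ-Cn-∪-∧¬ wld tr rc U∈𝓑 U⁺⊢δ δ≼¬α)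
          (⊢-cut₁ (reflexivity (inj₂ refl)) (⊢₁-tautology (p₀ ∧̇ ¬̇ p₁) (¬̇ p₁) (α ∷ β ∷ [])))

mainTheorem7 : ExcludedMiddle 0ℓ → ExcludedMiddle (Level.suc 0ℓ) →
    {At : Set} → Zorn (Form At) →
    (CR : ConsequenceRelation At) →
    let open Inference CR in
    (_≼_ : Form At → Form At → Set) → IsEntrenchment _≼_ →
    WeakLeftDisjunction _≼_ →
    (∀ α β → _|~_ _≼_ α β → _|~ʷ_ _≼_ α β)
    × (Transitivity _≼_ → RightConjunction _≼_ →
       ∀ α β → _|~ʷ_ _≼_ α β → _|~_ _≼_ α β)
mainTheorem7 em _ zorn CR _≼_ entrenchment wld =
  |~⇒|~ʷ em zorn , |~ʷ⇒|~ em zorn wld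
  where open Consequence.Entrenchment CR _≼_ entrenchment
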